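{- None of the groups $\mathbb{Z}_3\times\mathbb{Z}_2^2$, $\mathbb{Z}_7\times\mathbb{Z}_2^3$, $\mathbb{Z}_5\times\mathbb{Z}_2^4$ is a CI-group with respect to ternary relational structures.
   Context: A ternary relational structure is a pair $X=(V,E)$ with $E\subseteq V^3$; automorphisms are permutations of $V$ preserving $E$. For a group $H$, $H_L=\{h\mapsto gh: g\in H\}$. $X$ is a Cayley object of $H$ if $V=H$ and $H_L\le\mathrm{Aut}(X)$. $H$ is a CI-group with respect to a class $\mathcal{C}$ of Cayley objects of $H$ if any two $X,Y\in\mathcal{C}$ are isomorphic if and only if they are isomorphic via a group automorphism of $H$. -}

module Defs where

open import Level using (Level; suc; _⊔_) renaming (zero to lzero)
open import Data.Nat using (ℕ; _+_; _%_)
import Data.Nat as ℕ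
open import Data.Nat.DivMod using (m%n<n)
open import Data.Fin using (Fin; toℕ; fromℕ<)
open import Data.Bool using (Bool; _xor_)
open import Data.Vec using (Vec; zipWith)
open import Data.Product using (Σ; _×_; _,_)
open import Function.Bundles using (_↔_; _⇔_; Inverse)
open import Relation.Binary.PropositionalEquality using (_≡_)

_+ₘ_ : {m : ℕ} → Fin (ℕ.suc m) → Fin (ℕ.suc m) → Fin (ℕ.suc m)
_+ₘ_ {m} a b = fromℕ< (m%n<n (toℕ a + toℕ b) (ℕ.suc m))

-- elements of Z_{suc m} × Z_2^k ; Z_2 is Bool with xor
ZxZ2^ : ℕ → ℕ → Set
ZxZ2^ m k = Fin (ℕ.suc m) × Vec Bool k

op : {m k : ℕ} → ZxZ2^ m k → ZxZ2^ m k → ZxZ2^ m k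
op (a , u) (b , v) = (a +ₘ b , zipWith _xor_ u v)

TernaryRel : Set → Set₁
TernaryRel V = V → V → V → Set

IsIsoVia : {V : Set} → (V ↔ V) → TernaryRel V → TernaryRel V → Set
IsIsoVia f E F = ∀ x y z → E x y z ⇔ F (to x) (to y) (to z)
  where open Inverse f

Isomorphic : {V : Set} → TernaryRel V → TernaryRel V → Set
Isomorphic {V} E F = Σ (V ↔ V) λ f → IsIsoVia f E F

IsCayley : {H : Set} → (H → H → H) → TernaryRel H → Set
IsCayley _∙_ E = ∀ g x y z → E x y z ⇔ E (g ∙ x) (g ∙ y) (g ∙ z)

IsGroupAut : {H : Set} → (H → H → H) → (H ↔ H) → Set
IsGroupAut _∙_ φ = ∀ x y → to (x ∙ y) ≡ (to x ∙ to y)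
  where open Inverse φ

IsoViaGroupAut : {H : Set} → (H → H → H) → TernaryRel H → TernaryRel H → Set
IsoViaGroupAut {H} _∙_ E F = Σ (H ↔ H) λ φ → IsGroupAut _∙_ φ × IsIsoVia φ E F

IsCIGroupTernary : {H : Set} → (H → H → H) → Set₁
IsCIGroupTernary {H} _∙_ =
  ∀ (E F : TernaryRel H) → IsCayley _∙_ E → IsCayley _∙_ F →
    (Isomorphic E F ⇔ IsoViaGroupAut _∙_ E F)

-- Let ω be a linear automorphism of ℤ₂ᵏ with ωⁿ = 1 such that ω² fixes no
-- nonzero vector, and put λ = 1 + ω⁻¹ and c = 1 + ω. On ℤₙ × ℤ₂ᵏ consider the
-- Cayley ternary structures E and F consisting of the triples (x, xy, xz) with
-- (y, z) = ((0, s), (0, λs)) or ((1, s), (2, λs)) for E, and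
-- (y, z) = ((0, s), (0, λs)) or ((1, s), (2, cs)) for F.
-- The bijection (a, v) ↦ (a, ωᵃv) maps E onto F: on triples of the second kind
-- this comes down to the identity ω²λ = ωc. A group automorphism mapping E onto F
-- must instead fix (1, 0) and restrict to a map ψ of ℤ₂ᵏ commuting with λ; the
-- triple (e, (1, u), (2, λu)) then gives λ(ψu) = c(ψu), so ψu = 0 because
-- c − λ = ω + ω⁻¹ is injective, which is absurd for u ≠ 0.

module Submission where

open import Defs
open import Algebra.Bundles using (CommutativeMonoid)
open import Data.Bool using (Bool; true; false; _xor_)
import Data.Bool.Properties as Bool
open import Data.Empty using (⊥; ⊥-elim)
open import Data.Fin using (Fin; zero; suc; toℕ; fromℕ<)
import Data.Fin.Properties as Fin
open import Data.Nat as ℕ using (ℕ; _+_; _*_; _∸_; _%_; _/_)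
open import Data.Nat.DivMod
  using (m%n<n; %-distribˡ-+; m%n%n≡m%n; [m+n]%n≡m%n; m<n⇒m%n≡m; m≡m%n+[m/n]*n)
import Data.Nat.Properties as ℕ
open import Algebra.Properties.CommutativeSemigroup ℕ.+-commutativeSemigroup using (x∙yz≈y∙xz)
open import Data.Product using (_×_; _,_; proj₁; proj₂)
open import Data.Sum using (_⊎_; inj₁; inj₂)
open import Data.Vec using (Vec; []; _∷_; zipWith; replicate)
import Data.Vec.Properties as Vec
open import Function using (id; _∘_)
open import Function.Bundles using (_↔_; _⇔_; Inverse; Injection; Equivalence; mk↔ₛ′; mk⇔)
open import Function.Properties.Equivalence using (⇔-setoid)
open import Function.Properties.Inverse using (↔⇒↣)
open import Level using (0ℓ)
open import Relation.Binary.PropositionalEquality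
import Relation.Binary.Reasoning.Setoid (⇔-setoid 0ℓ) as ⇔-Reasoning
open import Relation.Nullary using (¬_; Dec; map′; _×-dec_; _→-dec_)
open import Relation.Nullary.Decidable using (True; toWitness)

module _ {A : Set} where
  open import Function.Endo.Propositional A public using (_^_; ^-homo)

-- The cyclic group ℤₙ

module _ {m : ℕ} where
  private
    n : ℕ
    n = ℕ.suc m

  infixl 6 _-ₘ_

  _-ₘ_ : Fin n → Fin n → Fin n
  a -ₘ b = fromℕ< (m%n<n (toℕ a + (n ∸ toℕ b)) n)

  [m%n+o]%n≡[m+o]%n : ∀ x y → (x % n + y) % n ≡ (x + y) % n
  [m%n+o]%n≡[m+o]%n x y = begin
    (x % n + y) % n         ≡⟨ %-distribˡ-+ (x % n) y n ⟩
    (x % n % n + y % n) % n ≡⟨ cong (λ z → (z + y % n) % n) (m%n%n≡m%n x n) ⟩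
    (x % n + y % n) % n     ≡⟨ %-distribˡ-+ x y n ⟨
    (x + y) % n             ∎
    where open ≡-Reasoning

  [m+o%n]%n≡[m+o]%n : ∀ x y → (x + y % n) % n ≡ (x + y) % n
  [m+o%n]%n≡[m+o]%n x y = begin
    (x + y % n) % n ≡⟨ cong (_% n) (ℕ.+-comm x (y % n)) ⟩
    (y % n + x) % n ≡⟨ [m%n+o]%n≡[m+o]%n y x ⟩
    (y + x) % n     ≡⟨ cong (_% n) (ℕ.+-comm y x) ⟩
    (x + y) % n     ∎
    where open ≡-Reasoning

  toℕ-+ₘ : (a b : Fin n) → toℕ (a +ₘ b) ≡ (toℕ a + toℕ b) % n
  toℕ-+ₘ a b = Fin.toℕ-fromℕ< _

  +ₘ-assoc : (a b c : Fin n) → (a +ₘ b) +ₘ c ≡ a +ₘ (b +ₘ c)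
  +ₘ-assoc a b c = Fin.toℕ-injective (begin
    toℕ ((a +ₘ b) +ₘ c)        ≡⟨ toℕ-+ₘ (a +ₘ b) c ⟩
    (toℕ (a +ₘ b) + c′) % n    ≡⟨ cong (λ z → (z + c′) % n) (toℕ-+ₘ a b) ⟩
    ((a′ + b′) % n + c′) % n   ≡⟨ [m%n+o]%n≡[m+o]%n (a′ + b′) c′ ⟩
    (a′ + b′ + c′) % n         ≡⟨ cong (_% n) (ℕ.+-assoc a′ b′ c′) ⟩
    (a′ + (b′ + c′)) % n       ≡⟨ [m+o%n]%n≡[m+o]%n a′ (b′ + c′) ⟨
    (a′ + (b′ + c′) % n) % n   ≡⟨ cong (λ z → (a′ + z) % n) (toℕ-+ₘ b c) ⟨
    (a′ + toℕ (b +ₘ c)) % n    ≡⟨ toℕ-+ₘ a (b +ₘ c) ⟨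
    toℕ (a +ₘ (b +ₘ c))        ∎)
    where
    open ≡-Reasoning
    a′ = toℕ a; b′ = toℕ b; c′ = toℕ c

  +ₘ-comm : (a b : Fin n) → a +ₘ b ≡ b +ₘ a
  +ₘ-comm a b = Fin.toℕ-injective (begin
    toℕ (a +ₘ b)          ≡⟨ toℕ-+ₘ a b ⟩
    (toℕ a + toℕ b) % n   ≡⟨ cong (_% n) (ℕ.+-comm (toℕ a) (toℕ b)) ⟩
    (toℕ b + toℕ a) % n   ≡⟨ toℕ-+ₘ b a ⟨
    toℕ (b +ₘ a)          ∎)
    where open ≡-Reasoning

  +ₘ-identityˡ : (a : Fin n) → zero +ₘ a ≡ a
  +ₘ-identityˡ a = Fin.toℕ-injective (trans (toℕ-+ₘ zero a) (m<n⇒m%n≡m (Fin.toℕ<n a)))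

  +ₘ-identityʳ : (a : Fin n) → a +ₘ zero ≡ a
  +ₘ-identityʳ a = trans (+ₘ-comm a zero) (+ₘ-identityˡ a)

  +ₘ-[-ₘ] : (a b : Fin n) → a +ₘ (b -ₘ a) ≡ b
  +ₘ-[-ₘ] a b = Fin.toℕ-injective (begin
    toℕ (a +ₘ (b -ₘ a))              ≡⟨ toℕ-+ₘ a (b -ₘ a) ⟩
    (a′ + toℕ (b -ₘ a)) % n          ≡⟨ cong (λ z → (a′ + z) % n) (Fin.toℕ-fromℕ< _) ⟩
    (a′ + (b′ + (n ∸ a′)) % n) % n   ≡⟨ [m+o%n]%n≡[m+o]%n a′ (b′ + (n ∸ a′)) ⟩
    (a′ + (b′ + (n ∸ a′))) % n       ≡⟨ cong (_% n) (x∙yz≈y∙xz a′ b′ (n ∸ a′)) ⟩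
    (b′ + (a′ + (n ∸ a′))) % n       ≡⟨ cong (λ z → (b′ + z) % n) (ℕ.m+[n∸m]≡n (ℕ.<⇒≤ (Fin.toℕ<n a))) ⟩
    (b′ + n) % n                     ≡⟨ [m+n]%n≡m%n b′ n ⟩
    b′ % n                           ≡⟨ m<n⇒m%n≡m (Fin.toℕ<n b) ⟩
    b′                               ∎)
    where
    open ≡-Reasoning
    a′ = toℕ a; b′ = toℕ b

  [-ₘ]-+ₘ : (a b : Fin n) → (b -ₘ a) +ₘ a ≡ b
  [-ₘ]-+ₘ a b = trans (+ₘ-comm (b -ₘ a) a) (+ₘ-[-ₘ] a b)

  +ₘ-cancelˡ : (a b c : Fin n) → a +ₘ b ≡ a +ₘ c → b ≡ c
  +ₘ-cancelˡ a b c eq = begin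
    b                           ≡⟨ +ₘ-identityˡ b ⟨
    zero +ₘ b                   ≡⟨ cong (_+ₘ b) ([-ₘ]-+ₘ a zero) ⟨
    ((zero -ₘ a) +ₘ a) +ₘ b     ≡⟨ +ₘ-assoc (zero -ₘ a) a b ⟩
    (zero -ₘ a) +ₘ (a +ₘ b)     ≡⟨ cong ((zero -ₘ a) +ₘ_) eq ⟩
    (zero -ₘ a) +ₘ (a +ₘ c)     ≡⟨ +ₘ-assoc (zero -ₘ a) a c ⟨
    ((zero -ₘ a) +ₘ a) +ₘ c     ≡⟨ cong (_+ₘ c) ([-ₘ]-+ₘ a zero) ⟩
    zero +ₘ c                   ≡⟨ +ₘ-identityˡ c ⟩
    c                           ∎
    where open ≡-Reasoning

  -ₘ-unique : (a b d : Fin n) → a +ₘ d ≡ b → d ≡ b -ₘ a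
  -ₘ-unique a b d eq = +ₘ-cancelˡ a d (b -ₘ a) (trans eq (sym (+ₘ-[-ₘ] a b)))

  -ₘ-translation : (g a b : Fin n) → (g +ₘ b) -ₘ (g +ₘ a) ≡ b -ₘ a
  -ₘ-translation g a b = sym (-ₘ-unique (g +ₘ a) (g +ₘ b) (b -ₘ a) (begin
    (g +ₘ a) +ₘ (b -ₘ a) ≡⟨ +ₘ-assoc g a (b -ₘ a) ⟩
    g +ₘ (a +ₘ (b -ₘ a)) ≡⟨ cong (g +ₘ_) (+ₘ-[-ₘ] a b) ⟩
    g +ₘ b               ∎))
    where open ≡-Reasoning

  -ₘ-identityʳ : (a : Fin n) → a -ₘ zero ≡ a
  -ₘ-identityʳ a = sym (-ₘ-unique zero a a (+ₘ-identityˡ a))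

-- The elementary abelian group ℤ₂ᵏ and its linear maps

infixl 6 _⊕_

_⊕_ : ∀ {k} → Vec Bool k → Vec Bool k → Vec Bool k
_⊕_ = zipWith _xor_

0ᵛ : ∀ {k} → Vec Bool k
0ᵛ = replicate _ false

module _ {k : ℕ} where

  ⊕-assoc : (x y z : Vec Bool k) → x ⊕ y ⊕ z ≡ x ⊕ (y ⊕ z)
  ⊕-assoc = Vec.zipWith-assoc Bool.xor-assoc

  ⊕-comm : (x y : Vec Bool k) → x ⊕ y ≡ y ⊕ x
  ⊕-comm = Vec.zipWith-comm Bool.xor-comm

  ⊕-identityˡ : (x : Vec Bool k) → 0ᵛ ⊕ x ≡ x
  ⊕-identityˡ = Vec.zipWith-identityˡ Bool.xor-identityˡ

  ⊕-identityʳ : (x : Vec Bool k) → x ⊕ 0ᵛ ≡ x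
  ⊕-identityʳ = Vec.zipWith-identityʳ Bool.xor-identityʳ

  ⊕-self : (x : Vec Bool k) → x ⊕ x ≡ 0ᵛ
  ⊕-self x = trans (cong (x ⊕_) (sym (Vec.map-id x))) (Vec.zipWith-inverseʳ Bool.xor-same x)

  ⊕-commutativeMonoid : CommutativeMonoid 0ℓ 0ℓ
  ⊕-commutativeMonoid = record
    { isCommutativeMonoid = record
      { isMonoid = record
        { isSemigroup = record
          { isMagma = record { isEquivalence = isEquivalence ; ∙-cong = cong₂ _⊕_ }
          ; assoc = ⊕-assoc
          }
        ; identity = ⊕-identityˡ , ⊕-identityʳ
        }
      ; comm = ⊕-comm
      }
    }

  ⊕-self-cancelʳ : (x y : Vec Bool k) → x ⊕ (y ⊕ y) ≡ x
  ⊕-self-cancelʳ x y = trans (cong (x ⊕_) (⊕-self y)) (⊕-identityʳ x)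

  ⊕-cancelˡ : (x y z : Vec Bool k) → x ⊕ y ≡ x ⊕ z → y ≡ z
  ⊕-cancelˡ x y z eq = begin
    y           ≡⟨ ⊕-identityˡ y ⟨
    0ᵛ ⊕ y      ≡⟨ cong (_⊕ y) (⊕-self x) ⟨
    x ⊕ x ⊕ y   ≡⟨ ⊕-assoc x x y ⟩
    x ⊕ (x ⊕ y) ≡⟨ cong (x ⊕_) eq ⟩
    x ⊕ (x ⊕ z) ≡⟨ ⊕-assoc x x z ⟨
    x ⊕ x ⊕ z   ≡⟨ cong (_⊕ z) (⊕-self x) ⟩
    0ᵛ ⊕ z      ≡⟨ ⊕-identityˡ z ⟩
    z           ∎
    where open ≡-Reasoning

  ≡⇔⊕≡0ᵛ : {x y : Vec Bool k} → x ≡ y ⇔ x ⊕ y ≡ 0ᵛ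
  ≡⇔⊕≡0ᵛ {x} {y} = mk⇔ (λ { refl → ⊕-self x })
                        (λ eq → ⊕-cancelˡ x x y (trans (⊕-self x) (sym eq)))

IsLinear : ∀ {k} → (Vec Bool k → Vec Bool k) → Set
IsLinear f = ∀ x y → f (x ⊕ y) ≡ f x ⊕ f y

FixedPointFree : ∀ {k} → (Vec Bool k → Vec Bool k) → Set
FixedPointFree f = ∀ x → f x ≡ x → x ≡ 0ᵛ

1+_ : ∀ {k} → (Vec Bool k → Vec Bool k) → Vec Bool k → Vec Bool k
(1+ f) x = x ⊕ f x

module _ {k : ℕ} {f : Vec Bool k → Vec Bool k} (f-linear : IsLinear f) where

  linear⇒0ᵛ-fixed : f 0ᵛ ≡ 0ᵛ
  linear⇒0ᵛ-fixed = begin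
    f 0ᵛ          ≡⟨ cong f (⊕-self 0ᵛ) ⟨
    f (0ᵛ ⊕ 0ᵛ)   ≡⟨ f-linear 0ᵛ 0ᵛ ⟩
    f 0ᵛ ⊕ f 0ᵛ   ≡⟨ ⊕-self (f 0ᵛ) ⟩
    0ᵛ            ∎
    where open ≡-Reasoning

  ^-linear : ∀ i → IsLinear (f ^ i)
  ^-linear ℕ.zero    x y = refl
  ^-linear (ℕ.suc i) x y = trans (cong f (^-linear i x y)) (f-linear _ _)

^-periodic : {A : Set} (f : A → A) (n : ℕ) .{{_ : ℕ.NonZero n}} →
             f ^ n ≗ id → ∀ i → f ^ i ≗ f ^ (i % n)
^-periodic f n fⁿ≗id i x = begin
  (f ^ i) x                             ≡⟨ cong (λ j → (f ^ j) x) (m≡m%n+[m/n]*n i n) ⟩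
  (f ^ (i % n + i / n * n)) x           ≡⟨ cong-app (^-homo f (i % n) (i / n * n)) x ⟩
  (f ^ (i % n)) ((f ^ (i / n * n)) x)   ≡⟨ cong (f ^ (i % n)) (^-multiple (i / n) x) ⟩
  (f ^ (i % n)) x                       ∎
  where
  open ≡-Reasoning
  ^-multiple : ∀ q → f ^ (q * n) ≗ id
  ^-multiple ℕ.zero    x = refl
  ^-multiple (ℕ.suc q) x = begin
    (f ^ (n + q * n)) x         ≡⟨ cong-app (^-homo f n (q * n)) x ⟩
    (f ^ n) ((f ^ (q * n)) x)   ≡⟨ cong (f ^ n) (^-multiple q x) ⟩
    (f ^ n) x                   ≡⟨ fⁿ≗id x ⟩
    x                           ∎

module Powers {m k : ℕ} (ω : Vec Bool k → Vec Bool k) (ω-linear : IsLinear ω)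
              (ω-order : ω ^ ℕ.suc m ≗ id) where

  Ω : Fin (ℕ.suc m) → Vec Bool k → Vec Bool k
  Ω a = ω ^ toℕ a

  Ω-linear : ∀ a → IsLinear (Ω a)
  Ω-linear a = ^-linear ω-linear (toℕ a)

  Ω-+ₘ : ∀ a b x → Ω (a +ₘ b) x ≡ Ω a (Ω b x)
  Ω-+ₘ a b x = begin
    (ω ^ toℕ (a +ₘ b)) x                    ≡⟨ cong (λ i → (ω ^ i) x) (toℕ-+ₘ a b) ⟩
    (ω ^ ((toℕ a + toℕ b) % ℕ.suc m)) x     ≡⟨ ^-periodic ω (ℕ.suc m) ω-order (toℕ a + toℕ b) x ⟨
    (ω ^ (toℕ a + toℕ b)) x                 ≡⟨ cong-app (^-homo ω (toℕ a) (toℕ b)) x ⟩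
    Ω a (Ω b x)                             ∎
    where open ≡-Reasoning

  Ω-comm : ∀ a b x → Ω a (Ω b x) ≡ Ω b (Ω a x)
  Ω-comm a b x = begin
    Ω a (Ω b x)   ≡⟨ Ω-+ₘ a b x ⟨
    Ω (a +ₘ b) x  ≡⟨ cong (λ c → Ω c x) (+ₘ-comm a b) ⟩
    Ω (b +ₘ a) x  ≡⟨ Ω-+ₘ b a x ⟩
    Ω b (Ω a x)   ∎
    where open ≡-Reasoning

  Ω-inverseˡ : ∀ a x → Ω a (Ω (zero -ₘ a) x) ≡ x
  Ω-inverseˡ a x = trans (sym (Ω-+ₘ a (zero -ₘ a) x)) (cong (λ c → Ω c x) (+ₘ-[-ₘ] a zero))

  Ω-inverseʳ : ∀ a x → Ω (zero -ₘ a) (Ω a x) ≡ x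
  Ω-inverseʳ a x = trans (sym (Ω-+ₘ (zero -ₘ a) a x)) (cong (λ c → Ω c x) ([-ₘ]-+ₘ a zero))

  Ω-injective : ∀ a {x y} → Ω a x ≡ Ω a y → x ≡ y
  Ω-injective a {x} {y} eq =
    trans (sym (Ω-inverseʳ a x)) (trans (cong (Ω (zero -ₘ a)) eq) (Ω-inverseʳ a y))

  ≡0ᵛ⇔Ω≡0ᵛ : ∀ a {x} → x ≡ 0ᵛ ⇔ Ω a x ≡ 0ᵛ
  ≡0ᵛ⇔Ω≡0ᵛ a = mk⇔ (λ { refl → 0ᵛ-fixed })
                    (λ eq → Ω-injective a (trans eq (sym 0ᵛ-fixed)))
    where
    0ᵛ-fixed : Ω a 0ᵛ ≡ 0ᵛ
    0ᵛ-fixed = linear⇒0ᵛ-fixed (Ω-linear a)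

  equation-twist : {h : Vec Bool k → Vec Bool k} → (∀ a x → Ω a (h x) ≡ h (Ω a x)) →
                   ∀ a X Y → Y ≡ h X ⇔ Ω a Y ≡ h (Ω a X)
  equation-twist {h} Ω-h a X Y =
    mk⇔ (λ eq → trans (cong (Ω a) eq) (Ω-h a X))
        (λ eq → Ω-injective a (trans eq (sym (Ω-h a X))))

  twist : ZxZ2^ m k ↔ ZxZ2^ m k
  twist = mk↔ₛ′ (λ (a , v) → a , Ω a v) (λ (a , v) → a , Ω (zero -ₘ a) v)
                (λ (a , v) → cong (a ,_) (Ω-inverseˡ a v))
                (λ (a , v) → cong (a ,_) (Ω-inverseʳ a v))

-- Cayley ternary structures on ℤₙ × ℤ₂ᵏ

infixl 7 _⁻¹∙_

_⁻¹∙_ : ∀ {m k} → ZxZ2^ m k → ZxZ2^ m k → ZxZ2^ m k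
(a , v) ⁻¹∙ (b , w) = (b -ₘ a , w ⊕ v)

e : ∀ {m k} → ZxZ2^ m k
e = (zero , 0ᵛ)

e⁻¹∙ : ∀ {m k} (y : ZxZ2^ m k) → e ⁻¹∙ y ≡ y
e⁻¹∙ (b , w) = cong₂ _,_ (-ₘ-identityʳ b) (⊕-identityʳ w)

idempotent⇒e : ∀ {m k} (x : ZxZ2^ m k) → x ≡ op x x → x ≡ e
idempotent⇒e (a , s) eq = cong₂ _,_
  (sym (+ₘ-cancelˡ a zero a (trans (+ₘ-identityʳ a) (cong proj₁ eq))))
  (trans (cong proj₂ eq) (⊕-self s))

⁻¹∙-translation : ∀ {m k} (g x y : ZxZ2^ m k) → op g x ⁻¹∙ op g y ≡ x ⁻¹∙ y
⁻¹∙-translation {k = k} (c , u) (a , v) (b , w) =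
  cong₂ _,_ (-ₘ-translation c a b) (begin
    u ⊕ w ⊕ (u ⊕ v)     ≡⟨ solve 3 (λ u v w → (u ⊞ w) ⊞ (u ⊞ v) ⊜ (w ⊞ v) ⊞ (u ⊞ u)) refl u v w ⟩
    w ⊕ v ⊕ (u ⊕ u)     ≡⟨ ⊕-self-cancelʳ (w ⊕ v) u ⟩
    w ⊕ v               ∎)
  where
  open ≡-Reasoning
  open import Algebra.Solver.CommutativeMonoid (⊕-commutativeMonoid {k})
    using (solve; _⊜_) renaming (_⊕_ to _⊞_)

data Connection {m k} (μ ν : Vec Bool k → Vec Bool k) :
                ZxZ2^ (2 + m) k → ZxZ2^ (2 + m) k → Set where
  flat : ∀ {s t} → t ≡ μ s → Connection μ ν (zero , s) (zero , t)
  step : ∀ {s t} → t ≡ ν s → Connection μ ν (suc zero , s) (suc (suc zero) , t)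

Cay : ∀ {m k} (μ ν : Vec Bool k → Vec Bool k) → TernaryRel (ZxZ2^ (2 + m) k)
Cay μ ν x y z = Connection μ ν (x ⁻¹∙ y) (x ⁻¹∙ z)

module _ {m k : ℕ} {μ ν : Vec Bool k → Vec Bool k} where

  Cay-isCayley : IsCayley op (Cay {m} μ ν)
  Cay-isCayley g x y z =
    mk⇔ (subst₂ (Connection μ ν) (sym (⁻¹∙-translation g x y)) (sym (⁻¹∙-translation g x z)))
        (subst₂ (Connection μ ν) (⁻¹∙-translation g x y) (⁻¹∙-translation g x z))

  Cay-at-e : ∀ y z → Cay {m} μ ν e y z ⇔ Connection μ ν y z
  Cay-at-e y z = mk⇔ (subst₂ (Connection μ ν) (e⁻¹∙ y) (e⁻¹∙ z))
                     (subst₂ (Connection μ ν) (sym (e⁻¹∙ y)) (sym (e⁻¹∙ z)))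

  connection⁻¹ : ∀ {a b s t} → Connection {m} μ ν (a , s) (b , t) →
                 (a ≡ zero × b ≡ zero × t ≡ μ s) ⊎ (a ≡ suc zero × b ≡ suc (suc zero) × t ≡ ν s)
  connection⁻¹ (flat eq) = inj₁ (refl , refl , eq)
  connection⁻¹ (step eq) = inj₂ (refl , refl , eq)

  flat⁻¹ : ∀ {s t} → Connection {m} μ ν (zero , s) (zero , t) → t ≡ μ s
  flat⁻¹ (flat eq) = eq

  step⁻¹ : ∀ {s t} → Connection {m} μ ν (suc zero , s) (suc (suc zero) , t) → t ≡ ν s
  step⁻¹ (step eq) = eq

-- Two isomorphic Cayley structures not isomorphic by a group automorphism

module NonCI {m k : ℕ} (ω : Vec Bool (ℕ.suc k) → Vec Bool (ℕ.suc k)) (ω-linear : IsLinear ω)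
             (ω-order : ω ^ (3 + m) ≗ id) (ω²-fixedPointFree : FixedPointFree (ω ∘ ω)) where

  open Powers {2 + m} ω ω-linear ω-order

  G : Set
  G = ZxZ2^ (2 + m) (ℕ.suc k)

  one two : Fin (3 + m)
  one = suc zero
  two = suc (suc zero)

  one≢zero : one ≢ zero
  one≢zero ()

  two≢zero : two ≢ zero
  two≢zero ()

  ω⁻¹ : Vec Bool (ℕ.suc k) → Vec Bool (ℕ.suc k)
  ω⁻¹ = Ω (zero -ₘ one)

  ω-ω⁻¹ : ∀ x → ω (ω⁻¹ x) ≡ x
  ω-ω⁻¹ = Ω-inverseˡ one

  Ω-1+ : ∀ {g} → (∀ a x → Ω a (g x) ≡ g (Ω a x)) → ∀ a x → Ω a ((1+ g) x) ≡ (1+ g) (Ω a x)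
  Ω-1+ {g} Ω-g a x = trans (Ω-linear a x (g x)) (cong (Ω a x ⊕_) (Ω-g a x))

  Ω-1+ω : ∀ a x → Ω a ((1+ ω) x) ≡ (1+ ω) (Ω a x)
  Ω-1+ω = Ω-1+ (λ a → Ω-comm a one)

  Ω-1+ω⁻¹ : ∀ a x → Ω a ((1+ ω⁻¹) x) ≡ (1+ ω⁻¹) (Ω a x)
  Ω-1+ω⁻¹ = Ω-1+ (λ a → Ω-comm a (zero -ₘ one))

  ω-fixedPointFree : FixedPointFree ω
  ω-fixedPointFree x eq = ω²-fixedPointFree x (trans (cong ω eq) eq)

  [1+ω]x≡0ᵛ⇒x≡0ᵛ : ∀ x → (1+ ω) x ≡ 0ᵛ → x ≡ 0ᵛ
  [1+ω]x≡0ᵛ⇒x≡0ᵛ x eq = ω-fixedPointFree x (sym (Equivalence.from ≡⇔⊕≡0ᵛ eq))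

  [1+ω⁻¹]x≡0ᵛ⇒x≡0ᵛ : ∀ x → (1+ ω⁻¹) x ≡ 0ᵛ → x ≡ 0ᵛ
  [1+ω⁻¹]x≡0ᵛ⇒x≡0ᵛ x eq =
    ω-fixedPointFree x (trans (cong ω (Equivalence.from ≡⇔⊕≡0ᵛ eq)) (ω-ω⁻¹ x))

  [1+ω⁻¹]x≡[1+ω]x⇒x≡0ᵛ : ∀ x → (1+ ω⁻¹) x ≡ (1+ ω) x → x ≡ 0ᵛ
  [1+ω⁻¹]x≡[1+ω]x⇒x≡0ᵛ x eq =
    ω²-fixedPointFree x (sym (trans (sym (ω-ω⁻¹ x)) (cong ω (⊕-cancelˡ x _ _ eq))))

  defect-twist : ∀ v w t → (ω (ω t) ⊕ v) ⊕ (1+ ω) (ω w ⊕ v) ≡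
                           ω (ω ((t ⊕ v) ⊕ (1+ ω⁻¹) (w ⊕ v)))
  defect-twist v w t = begin
    (L t ⊕ v) ⊕ ((ω w ⊕ v) ⊕ ω (ω w ⊕ v))
      ≡⟨ cong (λ z → (L t ⊕ v) ⊕ ((ω w ⊕ v) ⊕ z)) (ω-linear (ω w) v) ⟩
    (L t ⊕ v) ⊕ ((ω w ⊕ v) ⊕ (L w ⊕ ω v))
      ≡⟨ solve 6 (λ Lt Lw ωw ωv v Lv → (Lt ⊞ v) ⊞ ((ωw ⊞ v) ⊞ (Lw ⊞ ωv)) ⊜
                                      (((Lt ⊞ Lw) ⊞ ωw) ⊞ ωv) ⊞ (v ⊞ v)) refl (L t) (L w) (ω w) (ω v) v (L v) ⟩
    (L t ⊕ L w ⊕ ω w ⊕ ω v) ⊕ (v ⊕ v)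
      ≡⟨ ⊕-self-cancelʳ _ v ⟩
    L t ⊕ L w ⊕ ω w ⊕ ω v
      ≡⟨ ⊕-self-cancelʳ _ (L v) ⟨
    (L t ⊕ L w ⊕ ω w ⊕ ω v) ⊕ (L v ⊕ L v)
      ≡⟨ solve 6 (λ Lt Lw ωw ωv v Lv → (((Lt ⊞ Lw) ⊞ ωw) ⊞ ωv) ⊞ (Lv ⊞ Lv) ⊜
                                      (Lt ⊞ Lv) ⊞ ((Lw ⊞ Lv) ⊞ (ωw ⊞ ωv))) refl (L t) (L w) (ω w) (ω v) v (L v) ⟩
    (L t ⊕ L v) ⊕ ((L w ⊕ L v) ⊕ (ω w ⊕ ω v))
      ≡⟨ cong₂ (λ p q → p ⊕ (q ⊕ (ω w ⊕ ω v))) (L-linear t v) (L-linear w v) ⟨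
    L (t ⊕ v) ⊕ (L (w ⊕ v) ⊕ (ω w ⊕ ω v))
      ≡⟨ cong (λ z → L (t ⊕ v) ⊕ (L (w ⊕ v) ⊕ z)) (trans (cong ω (ω-ω⁻¹ (w ⊕ v))) (ω-linear w v)) ⟨
    L (t ⊕ v) ⊕ (L (w ⊕ v) ⊕ L (ω⁻¹ (w ⊕ v)))
      ≡⟨ cong (L (t ⊕ v) ⊕_) (L-linear (w ⊕ v) (ω⁻¹ (w ⊕ v))) ⟨
    L (t ⊕ v) ⊕ L ((1+ ω⁻¹) (w ⊕ v))
      ≡⟨ L-linear (t ⊕ v) _ ⟨
    L ((t ⊕ v) ⊕ (1+ ω⁻¹) (w ⊕ v))
      ∎
    where
    open ≡-Reasoning
    open import Algebra.Solver.CommutativeMonoid (⊕-commutativeMonoid {ℕ.suc k})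
      using (solve; _⊜_) renaming (_⊕_ to _⊞_)
    L : Vec Bool (ℕ.suc k) → Vec Bool (ℕ.suc k)
    L = Ω two
    L-linear : IsLinear L
    L-linear = Ω-linear two

  step-equation-twist : ∀ v w t → t ⊕ v ≡ (1+ ω⁻¹) (w ⊕ v) ⇔ ω (ω t) ⊕ v ≡ (1+ ω) (ω w ⊕ v)
  step-equation-twist v w t = begin
    t ⊕ v ≡ (1+ ω⁻¹) (w ⊕ v)                            ≈⟨ ≡⇔⊕≡0ᵛ ⟩
    (t ⊕ v) ⊕ (1+ ω⁻¹) (w ⊕ v) ≡ 0ᵛ                     ≈⟨ ≡0ᵛ⇔Ω≡0ᵛ two ⟩
    ω (ω ((t ⊕ v) ⊕ (1+ ω⁻¹) (w ⊕ v))) ≡ 0ᵛ             ≡⟨ cong (_≡ 0ᵛ) (defect-twist v w t) ⟨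
    (ω (ω t) ⊕ v) ⊕ (1+ ω) (ω w ⊕ v) ≡ 0ᵛ               ≈⟨ ≡⇔⊕≡0ᵛ ⟨
    ω (ω t) ⊕ v ≡ (1+ ω) (ω w ⊕ v)                      ∎
    where open ⇔-Reasoning

  E F : TernaryRel G
  E = Cay (1+ ω⁻¹) (1+ ω⁻¹)
  F = Cay (1+ ω⁻¹) (1+ ω)

  connection-twistʳ : ∀ a {δ₁ δ₂} v w t →
    Connection (1+ ω⁻¹) (1+ ω⁻¹) (δ₁ , w ⊕ v) (δ₂ , t ⊕ v) →
    Connection (1+ ω⁻¹) (1+ ω) (δ₁ , Ω a (Ω δ₁ w ⊕ v)) (δ₂ , Ω a (Ω δ₂ t ⊕ v))
  connection-twistʳ a v w t (flat eq) =
    flat (Equivalence.to (equation-twist Ω-1+ω⁻¹ a _ _) eq)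
  connection-twistʳ a v w t (step eq) =
    step (Equivalence.to (equation-twist Ω-1+ω a _ _) (Equivalence.to (step-equation-twist v w t) eq))

  connection-twistˡ : ∀ a {δ₁ δ₂} v w t →
    Connection (1+ ω⁻¹) (1+ ω) (δ₁ , Ω a (Ω δ₁ w ⊕ v)) (δ₂ , Ω a (Ω δ₂ t ⊕ v)) →
    Connection (1+ ω⁻¹) (1+ ω⁻¹) (δ₁ , w ⊕ v) (δ₂ , t ⊕ v)
  connection-twistˡ a v w t (flat eq) =
    flat (Equivalence.from (equation-twist Ω-1+ω⁻¹ a _ _) eq)
  connection-twistˡ a v w t (step eq) =
    step (Equivalence.from (step-equation-twist v w t) (Equivalence.from (equation-twist Ω-1+ω a _ _) eq))

  ⁻¹∙-twist : ∀ a b v w → Ω b w ⊕ Ω a v ≡ Ω a (Ω (b -ₘ a) w ⊕ v)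
  ⁻¹∙-twist a b v w = begin
    Ω b w ⊕ Ω a v                  ≡⟨ cong (λ c → Ω c w ⊕ Ω a v) (+ₘ-[-ₘ] a b) ⟨
    Ω (a +ₘ (b -ₘ a)) w ⊕ Ω a v    ≡⟨ cong (_⊕ Ω a v) (Ω-+ₘ a (b -ₘ a) w) ⟩
    Ω a (Ω (b -ₘ a) w) ⊕ Ω a v     ≡⟨ Ω-linear a _ v ⟨
    Ω a (Ω (b -ₘ a) w ⊕ v)         ∎
    where open ≡-Reasoning

  twist-isIso : IsIsoVia twist E F
  twist-isIso (a , v) (b , w) (d , t) =
    subst₂ (λ y z → E (a , v) (b , w) (d , t) ⇔ Connection (1+ ω⁻¹) (1+ ω) (b -ₘ a , y) (d -ₘ a , z))
           (sym (⁻¹∙-twist a b v w)) (sym (⁻¹∙-twist a d v t))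
           (mk⇔ (connection-twistʳ a v w t) (connection-twistˡ a v w t))

  module Automorphism (φ : G ↔ G) (φ-hom : IsGroupAut op φ) (φ-isIso : IsIsoVia φ E F) where

    open Inverse φ using () renaming (to to T)

    T-injective : ∀ {x y} → T x ≡ T y → x ≡ y
    T-injective = Injection.injective (↔⇒↣ φ)

    T-e : T e ≡ e
    T-e = idempotent⇒e (T e) (trans (cong T (cong (zero ,_) (sym (⊕-self 0ᵛ)))) (φ-hom e e))

    T-connection : ∀ {y z} → Connection (1+ ω⁻¹) (1+ ω⁻¹) y z → Connection (1+ ω⁻¹) (1+ ω) (T y) (T z)
    T-connection {y} {z} c = Equivalence.to (Cay-at-e (T y) (T z))
      (subst (λ x → F x (T y) (T z)) T-e (Equivalence.to (φ-isIso e y z) (Equivalence.from (Cay-at-e y z) c)))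

    ψ : Vec Bool (ℕ.suc k) → Vec Bool (ℕ.suc k)
    ψ u = proj₂ (T (zero , u))

    -- T (0, u) starts a connection, so its first coordinate is 0 or 1; it is
    -- not 1 because T (0, u) squares to e.
    T-zero-u : ∀ u → T (zero , u) ≡ (zero , ψ u)
    T-zero-u u = cong (_, ψ u) (first-component (connection⁻¹ (T-connection (flat {s = u} refl))))
      where
      a = proj₁ (T (zero , u))
      T-square : a +ₘ a ≡ zero
      T-square = trans (cong proj₁ (sym (φ-hom (zero , u) (zero , u))))
                       (trans (cong (λ x → proj₁ (T (zero , x))) (⊕-self u)) (cong proj₁ T-e))
      first-component : (a ≡ zero × _) ⊎ (a ≡ one × _) → a ≡ zero
      first-component (inj₁ (a≡zero , _)) = a≡zero
      first-component (inj₂ (a≡one , _)) =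
        ⊥-elim (two≢zero (trans (cong₂ _+ₘ_ (sym a≡one) (sym a≡one)) T-square))

    ψ-1+ω⁻¹ : ∀ u → ψ ((1+ ω⁻¹) u) ≡ (1+ ω⁻¹) (ψ u)
    ψ-1+ω⁻¹ u = flat⁻¹ (subst₂ (Connection (1+ ω⁻¹) (1+ ω)) (T-zero-u u) (T-zero-u _) (T-connection (flat refl)))

    T-one-0 : T (one , 0ᵛ) ≡ (one , 0ᵛ)
    T-one-0 = from-shape (connection⁻¹ (subst (Connection (1+ ω⁻¹) (1+ ω) (T (one , 0ᵛ))) T-square
                                            (T-connection (step (sym [1+ω⁻¹]0ᵛ≡0ᵛ)))))
      where
      a = proj₁ (T (one , 0ᵛ))
      s = proj₂ (T (one , 0ᵛ))
      [1+ω⁻¹]0ᵛ≡0ᵛ : (1+ ω⁻¹) 0ᵛ ≡ 0ᵛ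
      [1+ω⁻¹]0ᵛ≡0ᵛ = trans (⊕-identityˡ _) (linear⇒0ᵛ-fixed (Ω-linear (zero -ₘ one)))
      T-square : T (two , 0ᵛ) ≡ op (T (one , 0ᵛ)) (T (one , 0ᵛ))
      T-square = trans (cong (λ x → T (two , x)) (sym (⊕-self 0ᵛ))) (φ-hom (one , 0ᵛ) (one , 0ᵛ))
      from-shape : (a ≡ zero × a +ₘ a ≡ zero × s ⊕ s ≡ (1+ ω⁻¹) s) ⊎
                   (a ≡ one × a +ₘ a ≡ two × s ⊕ s ≡ (1+ ω) s) → T (one , 0ᵛ) ≡ (one , 0ᵛ)
      from-shape (inj₁ (a≡zero , _ , eq)) = ⊥-elim (one≢zero (cong proj₁ (T-injective (begin
        T (one , 0ᵛ)   ≡⟨ cong₂ _,_ a≡zero ([1+ω⁻¹]x≡0ᵛ⇒x≡0ᵛ s (trans (sym eq) (⊕-self s))) ⟩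
        e              ≡⟨ T-e ⟨
        T e            ∎))))
        where open ≡-Reasoning
      from-shape (inj₂ (a≡one , _ , eq)) = cong₂ _,_ a≡one ([1+ω]x≡0ᵛ⇒x≡0ᵛ s (trans (sym eq) (⊕-self s)))

    T-shift : ∀ x → T (op (one , 0ᵛ) x) ≡ op (one , 0ᵛ) (T x)
    T-shift x = trans (φ-hom (one , 0ᵛ) x) (cong (λ y → op y (T x)) T-one-0)

    T-one-u : ∀ u → T (one , u) ≡ (one , ψ u)
    T-one-u u = begin
      T (one , u)                   ≡⟨ cong (λ x → T (one , x)) (⊕-identityˡ u) ⟨
      T (op (one , 0ᵛ) (zero , u))  ≡⟨ T-shift (zero , u) ⟩
      op (one , 0ᵛ) (T (zero , u))  ≡⟨ cong (op (one , 0ᵛ)) (T-zero-u u) ⟩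
      (one , 0ᵛ ⊕ ψ u)              ≡⟨ cong (one ,_) (⊕-identityˡ (ψ u)) ⟩
      (one , ψ u)                   ∎
      where open ≡-Reasoning

    T-two-u : ∀ u → T (two , u) ≡ (two , ψ u)
    T-two-u u = begin
      T (two , u)                   ≡⟨ cong (λ x → T (two , x)) (⊕-identityˡ u) ⟨
      T (op (one , 0ᵛ) (one , u))   ≡⟨ T-shift (one , u) ⟩
      op (one , 0ᵛ) (T (one , u))   ≡⟨ cong (op (one , 0ᵛ)) (T-one-u u) ⟩
      (two , 0ᵛ ⊕ ψ u)              ≡⟨ cong (two ,_) (⊕-identityˡ (ψ u)) ⟩
      (two , ψ u)                   ∎
      where open ≡-Reasoning

    ψ≡0ᵛ : ∀ u → ψ u ≡ 0ᵛ
    ψ≡0ᵛ u = [1+ω⁻¹]x≡[1+ω]x⇒x≡0ᵛ (ψ u) (trans (sym (ψ-1+ω⁻¹ u)) (step⁻¹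
      (subst₂ (Connection (1+ ω⁻¹) (1+ ω)) (T-one-u u) (T-two-u _) (T-connection (step refl)))))

    every-vector-zero : ∀ u → u ≡ 0ᵛ
    every-vector-zero u = cong proj₂ (T-injective (begin
      T (zero , u)     ≡⟨ T-zero-u u ⟩
      (zero , ψ u)     ≡⟨ cong (zero ,_) (ψ≡0ᵛ u) ⟩
      e                ≡⟨ T-e ⟨
      T e              ∎))
      where open ≡-Reasoning

    absurd : ⊥
    absurd = true≢false (Vec.∷-injectiveˡ (every-vector-zero (true ∷ 0ᵛ)))
      where
      true≢false : true ≢ false
      true≢false ()

  fixedPointFree⇒¬CIGroupTernary : ¬ IsCIGroupTernary (op {2 + m} {ℕ.suc k})
  fixedPointFree⇒¬CIGroupTernary isCI =
    let φ , φ-hom , φ-isIso = Equivalence.to (isCI E F Cay-isCayley Cay-isCayley) (twist , twist-isIso)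
    in Automorphism.absurd φ φ-hom φ-isIso

-- The three groups

∀-Vec? : ∀ k {P : Vec Bool k → Set} → (∀ v → Dec (P v)) → Dec (∀ v → P v)
∀-Vec? ℕ.zero    P? = map′ (λ p → λ { [] → p }) (λ h → h []) (P? [])
∀-Vec? (ℕ.suc k) P? =
  map′ (λ (pᵗ , pᶠ) → λ { (true ∷ v) → pᵗ v ; (false ∷ v) → pᶠ v })
       (λ h → (λ v → h (true ∷ v)) , (λ v → h (false ∷ v)))
       (∀-Vec? k (λ v → P? (true ∷ v)) ×-dec ∀-Vec? k (λ v → P? (false ∷ v)))

module Decide {k : ℕ} (ω : Vec Bool k → Vec Bool k) where

  _≟_ : (x y : Vec Bool k) → Dec (x ≡ y)
  _≟_ = Vec.≡-dec Bool._≟_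

  isLinear? : Dec (IsLinear ω)
  isLinear? = ∀-Vec? k λ x → ∀-Vec? k λ y → ω (x ⊕ y) ≟ (ω x ⊕ ω y)

  order? : ∀ n → Dec (ω ^ n ≗ id)
  order? n = ∀-Vec? k λ x → (ω ^ n) x ≟ x

  fixedPointFree? : (f : Vec Bool k → Vec Bool k) → Dec (FixedPointFree f)
  fixedPointFree? f = ∀-Vec? k λ x → (f x ≟ x) →-dec (x ≟ 0ᵛ)

decided⇒¬CIGroupTernary : ∀ {m k} (ω : Vec Bool (ℕ.suc k) → Vec Bool (ℕ.suc k)) →
  let open Decide ω in
  {_ : True isLinear?} {_ : True (order? (3 + m))} {_ : True (fixedPointFree? (ω ∘ ω))} →
  ¬ IsCIGroupTernary (op {2 + m} {ℕ.suc k})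
decided⇒¬CIGroupTernary ω {linear} {order} {fixedPointFree} =
  NonCI.fixedPointFree⇒¬CIGroupTernary ω (toWitness linear) (toWitness order) (toWitness fixedPointFree)

-- Multiplication by x on 𝔽₂[x]/(p) in the basis 1, x, x², …, for
-- p = x² + x + 1, x³ + x + 1 and x⁴ + x³ + x² + x + 1 respectively.

ω₃ : Vec Bool 2 → Vec Bool 2
ω₃ (a ∷ b ∷ []) = b ∷ (a xor b) ∷ []

ω₇ : Vec Bool 3 → Vec Bool 3
ω₇ (a ∷ b ∷ c ∷ []) = c ∷ (a xor c) ∷ b ∷ []

ω₅ : Vec Bool 4 → Vec Bool 4
ω₅ (a ∷ b ∷ c ∷ d ∷ []) = d ∷ (a xor d) ∷ (b xor d) ∷ (c xor d) ∷ []

corollary2p4 : ¬ IsCIGroupTernary (op {2} {2}) × ¬ IsCIGroupTernary (op {6} {3}) × ¬ IsCIGroupTernary (op {4} {4})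
corollary2p4 = decided⇒¬CIGroupTernary ω₃ , decided⇒¬CIGroupTernary ω₇ , decided⇒¬CIGroupTernary ω₅
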